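{- Let $P\colon\mathcal{C}^{op}\to\mathbf{DLat}$ be a $\{\land,\lor\}$-doctrine with existential completion $P^\exists$ and unit $\eta\colon P\to P^\exists$ as described in the context, and let $Q\colon\mathcal{D}^{op}\to\mathbf{DLat}$ be a $\{\exists,\land,\lor\}$-doctrine. For every morphism of $\{\land,\lor\}$-doctrines $(F,\alpha)\colon P\to Q$ there is a unique morphism of $\{\exists,\land,\lor\}$-doctrines $(F,\alpha^\exists)\colon P^\exists\to Q$ such that $(F,\alpha^\exists)\circ\eta=(F,\alpha)$.
   Context: A $\{\land,\lor\}$-doctrine is a functor $P\colon\mathcal{C}^{op}\to\mathbf{DLat}$ ($\mathcal{C}$ with finite products, $1$ terminal, $\mathbf{DLat}$ distributive lattices with lattice homomorphisms); $f^\ast=P(f)$; $\pi_d\colon d\times c\to c$ is the projection forgetting $d$. It is a $\{\exists,\land,\lor\}$-doctrine if each $\pi_d^\ast$ has a left adjoint $\Sigma_d$ satisfying Frobenius ($x\land\Sigma_d y=\Sigma_d(\pi_d^\ast x\land y)$) and Beck–Chevalley ($f^\ast\Sigma_d=\Sigma_d(1_d\times f)^\ast$). A morphism of $\{\land,\lor\}$-doctrines $P\to Q$ is a pair $(F,\alpha)$ with $F\colon\mathcal{C}\to\mathcal{D}$ finite-product-preserving and $\alpha\colon P\Rightarrow Q\circ F^{op}$ natural with lattice-homomorphism components; it is a morphism of $\{\exists,\land,\lor\}$-doctrines if moreover $\alpha_c\circ\Sigma^P_d=\Sigma^Q_{Fd}\circ\alpha_{d\times c}$ (identifying $F(d\times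 c)\cong Fd\times Fc$). Composition: $(G,\beta)\circ(F,\alpha)=(GF,\beta_{F- }\circ\alpha)$. The completion: $P^\exists(c)$ is the posetal reflection of the preorder of finite sets $\{(d_1,x_1),\dots,(d_n,x_n)\}$ ($d_i\in\mathcal{C}$, $x_i\in P(d_i\times c)$) with $\{(d_i,x_i)\}_{i\le n}\le\{(e_j,y_j)\}_{j\le m}$ iff for each $i$ there are arrows $r_\ell\colon d_i\times c\to e_{j_\ell}\times c$ ($\ell=1,\dots,k$, $j_\ell\le m$) with $\pi_{e_{j_\ell}}\circ r_\ell=\pi_{d_i}$ and $x_i\le r_1^\ast y_{j_1}\lor\dots\lor r_k^\ast y_{j_k}$. $P^\exists(f)$ for $f\colon c'\to c$ sends $\{(d_i,x_i)\}$ to $\{(d_i,(1_{d_i}\times f)^\ast x_i)\}$; $\Sigma_d\colon P^\exists(d\times c)\to P^\exists(c)$ sends $\{(e_i,x_i)\}$ to $\{(e_i\times d,x_i)\}$. $P^\exists$ is a $\{\exists,\land,\lor\}$-doctrine. The unit $\eta=(1_\mathcal{C},\eta)$ has $\eta_c(x)=\{(1,x)\}$. -}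

module Defs where

open import Level using (Level; suc)
open import Data.Product using (Σ; Σ-syntax; _,_; proj₁; proj₂; ∃-syntax) renaming (_×_ to _∧ₚ_)
open import Data.List using (List; []; _∷_; map; foldr; length; lookup)
open import Data.List.Relation.Unary.All using (All)
open import Data.Fin using (Fin)
open import Relation.Binary.Core using (Rel)
open import Relation.Binary.Definitions using (Maximum; Minimum)
open import Relation.Binary.Lattice.Structures using (IsDistributiveLattice)
open import Relation.Binary.PropositionalEquality using (_≡_)

record CartCat (ℓ : Level) : Set (suc ℓ) where
  infixr 9 _∘_
  infixr 7 _×_
  field
    Obj : Set ℓ
    Hom : Obj → Obj → Set ℓ
    id  : ∀ {a} → Hom a a
    _∘_ : ∀ {a b c} → Hom b c → Hom a b → Hom a c
    identityˡ : ∀ {a b} (f : Hom a b) → id ∘ f ≡ f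
    identityʳ : ∀ {a b} (f : Hom a b) → f ∘ id ≡ f
    assoc : ∀ {a b c d} (h : Hom c d) (g : Hom b c) (f : Hom a b) →
            (h ∘ g) ∘ f ≡ h ∘ (g ∘ f)
    𝟙 : Obj
    ! : ∀ {a} → Hom a 𝟙
    !-unique : ∀ {a} (f : Hom a 𝟙) → f ≡ !
    _×_ : Obj → Obj → Obj
    π₁ : ∀ {a b} → Hom (a × b) a
    π₂ : ∀ {a b} → Hom (a × b) b
    ⟨_,_⟩ : ∀ {x a b} → Hom x a → Hom x b → Hom x (a × b)
    π₁-β : ∀ {x a b} (f : Hom x a) (g : Hom x b) → π₁ ∘ ⟨ f , g ⟩ ≡ f
    π₂-β : ∀ {x a b} (f : Hom x a) (g : Hom x b) → π₂ ∘ ⟨ f , g ⟩ ≡ g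
    ⟨⟩-unique : ∀ {x a b} (f : Hom x a) (g : Hom x b) (h : Hom x (a × b)) →
                π₁ ∘ h ≡ f → π₂ ∘ h ≡ g → h ≡ ⟨ f , g ⟩

  π : (d : Obj) {c : Obj} → Hom (d × c) c
  π d = π₂

  1×_ : ∀ {d c' c} → Hom c' c → Hom (d × c') (d × c)
  1× f = ⟨ π₁ , f ∘ π₂ ⟩

  assocʳ : ∀ {e d c} → Hom ((e × d) × c) (e × (d × c))
  assocʳ = ⟨ π₁ ∘ π₁ , ⟨ π₂ ∘ π₁ , π₂ ⟩ ⟩

record FPFunctor {ℓ} (C D : CartCat ℓ) : Set ℓ where
  private
    module C = CartCat C
    module D = CartCat D
  field
    F₀ : C.Obj → D.Obj
    F₁ : ∀ {a b} → C.Hom a b → D.Hom (F₀ a) (F₀ b)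
    F-id : ∀ {a} → F₁ (C.id {a}) ≡ D.id
    F-∘ : ∀ {a b c} (g : C.Hom b c) (f : C.Hom a b) → F₁ (g C.∘ f) ≡ F₁ g D.∘ F₁ f
    F𝟙-terminal : ∀ (x : D.Obj) → Σ[ h ∈ D.Hom x (F₀ C.𝟙) ] (∀ h' → h' ≡ h)
    φ : ∀ {d c} → D.Hom (F₀ d D.× F₀ c) (F₀ (d C.× c))
    φ-inverseˡ : ∀ {d c} → φ {d} {c} D.∘ D.⟨ F₁ C.π₁ , F₁ C.π₂ ⟩ ≡ D.id
    φ-inverseʳ : ∀ {d c} → D.⟨ F₁ C.π₁ , F₁ C.π₂ ⟩ D.∘ φ {d} {c} ≡ D.id

record BDLat (ℓ : Level) : Set (suc ℓ) where
  infixr 6 _∨_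
  infixr 7 _∧_
  field
    Carrier : Set ℓ
    _≈_ : Rel Carrier ℓ
    _≤_ : Rel Carrier ℓ
    _∨_ : Carrier → Carrier → Carrier
    _∧_ : Carrier → Carrier → Carrier
    ⊤ ⊥ : Carrier
    isDistributiveLattice : IsDistributiveLattice _≈_ _≤_ _∨_ _∧_
    maximum : Maximum _≤_ ⊤
    minimum : Minimum _≤_ ⊥

  ⋁ : List Carrier → Carrier
  ⋁ = foldr _∨_ ⊥

-- Lattice homomorphisms from a preordered set (S, ⊑) -- read through its
-- posetal reflection -- into a bounded distributive lattice L.

module _ {ℓ} {S : Set ℓ} (_⊑_ : Rel S ℓ) (L : BDLat ℓ) where
  open BDLat L

  IsGreatest : S → Set ℓ
  IsGreatest t = ∀ x → x ⊑ t

  IsLeast : S → Set ℓ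
  IsLeast b = ∀ x → b ⊑ x

  IsMeetOf : S → S → S → Set ℓ
  IsMeetOf x y m = (m ⊑ x) ∧ₚ (m ⊑ y) ∧ₚ (∀ z → z ⊑ x → z ⊑ y → z ⊑ m)

  IsJoinOf : S → S → S → Set ℓ
  IsJoinOf x y j = (x ⊑ j) ∧ₚ (y ⊑ j) ∧ₚ (∀ z → x ⊑ z → y ⊑ z → j ⊑ z)

  record IsLatticeHom (f : S → Carrier) : Set ℓ where
    field
      resp : ∀ x y → x ⊑ y → y ⊑ x → f x ≈ f y
      pres-⊤ : ∀ t → IsGreatest t → f t ≈ ⊤
      pres-⊥ : ∀ b → IsLeast b → f b ≈ ⊥
      pres-∧ : ∀ x y m → IsMeetOf x y m → f m ≈ (f x ∧ f y)
      pres-∨ : ∀ x y j → IsJoinOf x y j → f j ≈ (f x ∨ f y)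

record Doctrine {ℓ} (C : CartCat ℓ) : Set (suc ℓ) where
  open CartCat C
  field
    fib : Obj → BDLat ℓ
  Car : Obj → Set ℓ
  Car c = BDLat.Carrier (fib c)
  field
    reindex : ∀ {c' c} → Hom c' c → Car c → Car c'
    reindex-hom : ∀ {c' c} (f : Hom c' c) →
      IsLatticeHom (BDLat._≤_ (fib c)) (fib c') (reindex f)
    reindex-id : ∀ {c} (x : Car c) → BDLat._≈_ (fib c) (reindex id x) x
    reindex-∘ : ∀ {c'' c' c} (g : Hom c' c) (f : Hom c'' c') (x : Car c) →
      BDLat._≈_ (fib c'') (reindex (g ∘ f) x) (reindex f (reindex g x))

record ExDoctrine {ℓ} (C : CartCat ℓ) : Set (suc ℓ) where
  open CartCat C
  field
    doctrine : Doctrine C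
  open Doctrine doctrine
  field
    Σ∃ : (d : Obj) {c : Obj} → Car (d × c) → Car c
    adjunction-⇒ : ∀ d {c} (y : Car (d × c)) (x : Car c) →
      BDLat._≤_ (fib c) (Σ∃ d y) x → BDLat._≤_ (fib (d × c)) y (reindex (π d) x)
    adjunction-⇐ : ∀ d {c} (y : Car (d × c)) (x : Car c) →
      BDLat._≤_ (fib (d × c)) y (reindex (π d) x) → BDLat._≤_ (fib c) (Σ∃ d y) x
    frobenius : ∀ d {c} (x : Car c) (y : Car (d × c)) →
      BDLat._≈_ (fib c) (BDLat._∧_ (fib c) x (Σ∃ d y))
                        (Σ∃ d (BDLat._∧_ (fib (d × c)) (reindex (π d) x) y))
    beck-chevalley : ∀ d {c' c} (f : Hom c' c) (y : Car (d × c)) →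
      BDLat._≈_ (fib c') (reindex f (Σ∃ d y)) (Σ∃ d (reindex (1× f) y))

-- Raw doctrine data: fibres are preorders (to be read through their
-- posetal reflection), with reindexing maps.

record RawDoctrine {ℓ} (C : CartCat ℓ) : Set (suc ℓ) where
  open CartCat C
  field
    Car : Obj → Set ℓ
    _⊑_ : ∀ {c} → Rel (Car c) ℓ
    reindex : ∀ {c' c} → Hom c' c → Car c → Car c'

toRaw : ∀ {ℓ} {C : CartCat ℓ} → Doctrine C → RawDoctrine C
toRaw P = record
  { Car = Doctrine.Car P
  ; _⊑_ = λ {c} → BDLat._≤_ (Doctrine.fib P c)
  ; reindex = Doctrine.reindex P
  }

module Completion {ℓ} {C : CartCat ℓ} (P : Doctrine C) where
  open CartCat C
  open Doctrine P

  Entry : Obj → Set ℓ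
  Entry c = Σ[ d ∈ Obj ] Car (d × c)

  -- finite sets {(d₁,x₁),…,(dₙ,xₙ)} represented by lists
  Pᴱ₀ : Obj → Set ℓ
  Pᴱ₀ c = List (Entry c)

  Arrow : ∀ {c} (d : Obj) (Y : Pᴱ₀ c) → Set ℓ
  Arrow {c} d Y = Σ[ j ∈ Fin (length Y) ]
    Σ[ r ∈ Hom (d × c) (proj₁ (lookup Y j) × c) ] (π (proj₁ (lookup Y j)) ∘ r ≡ π d)

  pull : ∀ {c d} (Y : Pᴱ₀ c) → Arrow d Y → Car (d × c)
  pull Y (j , r , _) = reindex r (proj₂ (lookup Y j))

  Covered : ∀ {c} → Pᴱ₀ c → Entry c → Set ℓ
  Covered {c} Y (d , x) = Σ[ rs ∈ List (Arrow d Y) ]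
    BDLat._≤_ (fib (d × c)) x (BDLat.⋁ (fib (d × c)) (map (pull Y) rs))

  _⊑ᴱ_ : ∀ {c} → Rel (Pᴱ₀ c) ℓ
  X ⊑ᴱ Y = All (Covered Y) X

  reindexᴱ : ∀ {c' c} → Hom c' c → Pᴱ₀ c → Pᴱ₀ c'
  reindexᴱ f = map (λ { (d , x) → d , reindex (1× f) x })

  Pᴱ : RawDoctrine C
  Pᴱ = record { Car = Pᴱ₀ ; _⊑_ = _⊑ᴱ_ ; reindex = reindexᴱ }

  Σᴱ : (d : Obj) {c : Obj} → Pᴱ₀ (d × c) → Pᴱ₀ c
  Σᴱ d = map (λ { (e , x) → (e × d) , reindex assocʳ x })

  η : ∀ c → Car c → Pᴱ₀ c
  η c x = (𝟙 , reindex (π 𝟙) x) ∷ []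

module _ {ℓ} {C D : CartCat ℓ} (F : FPFunctor C D) where
  private
    module C = CartCat C
    module D = CartCat D
  open FPFunctor F

  record IsDoctrineMorphism (R : RawDoctrine C) (Q : Doctrine D)
         (α : ∀ c → RawDoctrine.Car R c → Doctrine.Car Q (F₀ c)) : Set ℓ where
    field
      natural : ∀ {c' c} (f : C.Hom c' c) (x : RawDoctrine.Car R c) →
        BDLat._≈_ (Doctrine.fib Q (F₀ c'))
          (α c' (RawDoctrine.reindex R f x))
          (Doctrine.reindex Q (F₁ f) (α c x))
      components : ∀ c →
        IsLatticeHom (RawDoctrine._⊑_ R {c}) (Doctrine.fib Q (F₀ c)) (α c)

  PreservesΣ : (R : RawDoctrine C)
    (ΣR : (d : C.Obj) {c : C.Obj} → RawDoctrine.Car R (d C.× c) → RawDoctrine.Car R c)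
    (Q : ExDoctrine D)
    (α : ∀ c → RawDoctrine.Car R c → Doctrine.Car (ExDoctrine.doctrine Q) (F₀ c)) → Set ℓ
  PreservesΣ R ΣR Q α = ∀ d {c} (y : RawDoctrine.Car R (d C.× c)) →
    BDLat._≈_ (Doctrine.fib (ExDoctrine.doctrine Q) (F₀ c))
      (α c (ΣR d y))
      (ExDoctrine.Σ∃ Q (F₀ d)
        (Doctrine.reindex (ExDoctrine.doctrine Q) (φ {d} {c}) (α (d C.× c) y)))

{-# OPTIONS --safe #-}
-- Every element {(d₁,x₁),…,(dₙ,xₙ)} of P^∃(c) is the join of its singletons, and
-- the singleton {(d,x)} is equivalent to Σ_d η(x). Hence a morphism of
-- {∃,∧,∨}-doctrines extending α must send it to ⋁ᵢ Σ_{F dᵢ} α(xᵢ), which gives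
-- uniqueness. Conversely this formula defines α^∃: it is monotone because Σ ⊣ π^*
-- turns a covering x ≤ ⋁ r^*y into Σ α(x) ≤ ⋁ Σ α(y); it preserves the meet of
-- two lists, which is the list of pairwise meets of entries, because Frobenius and
-- Beck–Chevalley rewrite Σ_{Fd} α(x) ∧ Σ_{Fe} α(y) as a single Σ_{F(d×e)}; and it
-- commutes with Σ because Σ_{Fd} ∘ Σ_{Fe} = Σ_{F(e×d)}.
module Submission where

open import Defs
open import Data.Product using (Σ; Σ-syntax; _×_; _,_; proj₁; proj₂)
open import Data.Fin using (Fin; zero; suc)
open import Data.List using ([]; _∷_; map; length; lookup; _++_; cartesianProductWith)
open import Data.List.Properties using (map-++; map-∘; map-cong)
open import Data.List.Relation.Unary.All as All using ([]; _∷_)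
open import Data.List.Relation.Unary.All.Properties using (++⁺; map⁺)
open import Function using (_⇔_; mk⇔; Equivalence)
open import Relation.Binary.Lattice.Bundles using (DistributiveLattice; BoundedJoinSemilattice)
import Relation.Binary.Lattice.Properties.JoinSemilattice as JoinSemilatticeProperties
import Relation.Binary.Lattice.Properties.MeetSemilattice as MeetSemilatticeProperties
import Relation.Binary.Lattice.Properties.BoundedJoinSemilattice as BoundedJoinSemilatticeProperties
import Relation.Binary.Lattice.Properties.DistributiveLattice as DistributiveLatticeProperties
import Relation.Binary.Reasoning.PartialOrder as PartialOrderReasoning
import Relation.Binary.Reasoning.Setoid as SetoidReasoning
open import Relation.Binary.PropositionalEquality as ≡ using (_≡_; refl; module ≡-Reasoning)

module BDLatProperties {ℓ} (L : BDLat ℓ) where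
  open BDLat L public using (Carrier; ⊤; ⊥; ⋁; maximum; minimum)

  distributiveLattice : DistributiveLattice ℓ ℓ ℓ
  distributiveLattice = record { isDistributiveLattice = BDLat.isDistributiveLattice L }

  open DistributiveLattice distributiveLattice public
    using (_≈_; _≤_; _∨_; _∧_; poset; setoid; x≤x∨y; y≤x∨y; ∨-least; x∧y≤x; x∧y≤y; ∧-greatest;
           antisym; reflexive; ∧-distribˡ-∨; module Eq)
    renaming (refl to ≤-refl; trans to ≤-trans)
  open DistributiveLattice distributiveLattice using (isJoinSemilattice; joinSemilattice; meetSemilattice)

  boundedJoinSemilattice : BoundedJoinSemilattice ℓ ℓ ℓ
  boundedJoinSemilattice = record
    { isBoundedJoinSemilattice = record { isJoinSemilattice = isJoinSemilattice ; minimum = minimum } }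

  open JoinSemilatticeProperties joinSemilattice public using (∨-monotonic; ∨-cong; ∨-assoc)
  open MeetSemilatticeProperties meetSemilattice public using (∧-cong; ∧-comm)
  open BoundedJoinSemilatticeProperties boundedJoinSemilattice public
    using () renaming (identityˡ to ∨-identityˡ; identityʳ to ∨-identityʳ)
  open DistributiveLatticeProperties distributiveLattice public using (∧-distribʳ-∨)

  module ≤-Reasoning = PartialOrderReasoning poset
  module ≈-Reasoning = SetoidReasoning setoid

  ⋁-++ : ∀ xs ys → ⋁ (xs ++ ys) ≈ ⋁ xs ∨ ⋁ ys
  ⋁-++ []       ys = Eq.sym (∨-identityˡ (⋁ ys))
  ⋁-++ (x ∷ xs) ys = Eq.trans (∨-cong Eq.refl (⋁-++ xs ys)) (Eq.sym (∨-assoc x (⋁ xs) (⋁ ys)))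

  lookup-≤-⋁-map : ∀ {A : Set ℓ} (f : A → Carrier) xs (j : Fin (length xs)) →
                   f (lookup xs j) ≤ ⋁ (map f xs)
  lookup-≤-⋁-map f (x ∷ xs) zero    = x≤x∨y _ _
  lookup-≤-⋁-map f (x ∷ xs) (suc j) = ≤-trans (lookup-≤-⋁-map f xs j) (y≤x∨y _ _)

module IsLatticeHomProperties {ℓ} {L M : BDLat ℓ} {f : BDLat.Carrier L → BDLat.Carrier M}
                              (f-hom : IsLatticeHom (BDLat._≤_ L) M f) where
  private
    module L = BDLatProperties L
    module M = BDLatProperties M
  open IsLatticeHom f-hom

  cong : ∀ {x y} → x L.≈ y → f x M.≈ f y
  cong x≈y = resp _ _ (L.reflexive x≈y) (L.reflexive (L.Eq.sym x≈y))

  ∧-homo : ∀ x y → f (x L.∧ y) M.≈ f x M.∧ f y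
  ∧-homo x y = pres-∧ x y _ (L.x∧y≤x x y , L.x∧y≤y x y , λ _ → L.∧-greatest)

  ∨-homo : ∀ x y → f (x L.∨ y) M.≈ f x M.∨ f y
  ∨-homo x y = pres-∨ x y _ (L.x≤x∨y x y , L.y≤x∨y x y , λ _ → L.∨-least)

  ⊥-homo : f L.⊥ M.≈ M.⊥
  ⊥-homo = pres-⊥ L.⊥ L.minimum

  ⊤-homo : f L.⊤ M.≈ M.⊤
  ⊤-homo = pres-⊤ L.⊤ L.maximum

  mono : ∀ {x y} → x L.≤ y → f x M.≤ f y
  mono {x} {y} x≤y = begin
    f x          ≈⟨ cong (L.antisym (L.∧-greatest L.≤-refl x≤y) (L.x∧y≤x x y)) ⟩
    f (x L.∧ y)  ≈⟨ ∧-homo x y ⟩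
    f x M.∧ f y  ≤⟨ M.x∧y≤y _ _ ⟩
    f y          ∎
    where open M.≤-Reasoning

module LeftAdjointProperties {ℓ} {L M : BDLat ℓ}
  (f : BDLat.Carrier L → BDLat.Carrier M) (g : BDLat.Carrier M → BDLat.Carrier L)
  (adjoint : ∀ {x y} → BDLat._≤_ M (f x) y ⇔ BDLat._≤_ L x (g y)) where
  private
    module L = BDLatProperties L
    module M = BDLatProperties M
  open Equivalence

  unit : ∀ x → x L.≤ g (f x)
  unit x = to adjoint M.≤-refl

  counit : ∀ y → f (g y) M.≤ y
  counit y = from adjoint L.≤-refl

  mono : ∀ {x y} → x L.≤ y → f x M.≤ f y
  mono x≤y = from adjoint (L.≤-trans x≤y (unit _))

  cong : ∀ {x y} → x L.≈ y → f x M.≈ f y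
  cong x≈y = M.antisym (mono (L.reflexive x≈y)) (mono (L.reflexive (L.Eq.sym x≈y)))

  ∨-homo : ∀ x y → f (x L.∨ y) M.≈ f x M.∨ f y
  ∨-homo x y = M.antisym
    (from adjoint (L.∨-least (to adjoint (M.x≤x∨y _ _)) (to adjoint (M.y≤x∨y _ _))))
    (M.∨-least (mono (L.x≤x∨y x y)) (mono (L.y≤x∨y x y)))

  ⊥-homo : f L.⊥ M.≈ M.⊥
  ⊥-homo = M.antisym (from adjoint (L.minimum _)) (M.minimum _)

module CartCatProperties {ℓ} (C : CartCat ℓ) where
  open CartCat C renaming (_×_ to _⊗_)
  open ≡-Reasoning

  ⟨⟩∘ : ∀ {x y a b} (f : Hom y a) (g : Hom y b) (h : Hom x y) → ⟨ f , g ⟩ ∘ h ≡ ⟨ f ∘ h , g ∘ h ⟩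
  ⟨⟩∘ f g h = ⟨⟩-unique _ _ _
    (≡.trans (≡.sym (assoc _ _ _)) (≡.cong (_∘ h) (π₁-β f g)))
    (≡.trans (≡.sym (assoc _ _ _)) (≡.cong (_∘ h) (π₂-β f g)))

  ⟨π₁,π₂⟩≡id : ∀ {a b} → ⟨ π₁ , π₂ ⟩ ≡ id {a ⊗ b}
  ⟨π₁,π₂⟩≡id = ≡.sym (⟨⟩-unique _ _ _ (identityʳ _) (identityʳ _))

  retraction⇒monic : ∀ {x a b} {s : Hom a b} {r : Hom b a} {h h' : Hom x a} →
                     r ∘ s ≡ id → s ∘ h ≡ s ∘ h' → h ≡ h'
  retraction⇒monic {s = s} {r} {h} {h'} r∘s≡id s∘h≡s∘h' = begin
    h             ≡⟨ ≡.sym (identityˡ h) ⟩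
    id ∘ h        ≡⟨ ≡.cong (_∘ h) (≡.sym r∘s≡id) ⟩
    (r ∘ s) ∘ h   ≡⟨ assoc r s h ⟩
    r ∘ (s ∘ h)   ≡⟨ ≡.cong (r ∘_) s∘h≡s∘h' ⟩
    r ∘ (s ∘ h')  ≡⟨ ≡.sym (assoc r s h') ⟩
    (r ∘ s) ∘ h'  ≡⟨ ≡.cong (_∘ h') r∘s≡id ⟩
    id ∘ h'       ≡⟨ identityˡ h' ⟩
    h'            ∎

  _×₁ : ∀ {a b c} → Hom a b → Hom (a ⊗ c) (b ⊗ c)
  f ×₁ = ⟨ f ∘ π₁ , π₂ ⟩

  ×₁-∘ : ∀ {a b b' c} (f : Hom b b') (g : Hom a b) → (_×₁ {c = c} f) ∘ (g ×₁) ≡ (f ∘ g) ×₁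
  ×₁-∘ f g = begin
    ⟨ f ∘ π₁ , π₂ ⟩ ∘ (g ×₁)             ≡⟨ ⟨⟩∘ _ _ _ ⟩
    ⟨ (f ∘ π₁) ∘ (g ×₁) , π₂ ∘ (g ×₁) ⟩  ≡⟨ ≡.cong₂ ⟨_,_⟩ (assoc _ _ _) (π₂-β _ _) ⟩
    ⟨ f ∘ (π₁ ∘ (g ×₁)) , π₂ ⟩           ≡⟨ ≡.cong (λ k → ⟨ f ∘ k , π₂ ⟩) (π₁-β _ _) ⟩
    ⟨ f ∘ (g ∘ π₁) , π₂ ⟩                ≡⟨ ≡.cong ⟨_, π₂ ⟩ (≡.sym (assoc _ _ _)) ⟩
    (f ∘ g) ×₁                           ∎

  id×₁ : ∀ {a c} → id {a} ×₁ ≡ id {a ⊗ c}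
  id×₁ = ≡.trans (≡.cong ⟨_, π₂ ⟩ (identityˡ _)) ⟨π₁,π₂⟩≡id

  π₂∘π₂∘assocʳ : ∀ {e d c} → (π₂ ∘ π₂) ∘ assocʳ {e} {d} {c} ≡ π₂
  π₂∘π₂∘assocʳ = ≡.trans (assoc _ _ _) (≡.trans (≡.cong (π₂ ∘_) (π₂-β _ _)) (π₂-β _ _))

  1×π₂∘assocʳ : ∀ {e d c} → 1× π₂ ∘ assocʳ {e} {d} {c} ≡ π₁ ×₁
  1×π₂∘assocʳ = begin
    ⟨ π₁ , π₂ ∘ π₂ ⟩ ∘ assocʳ             ≡⟨ ⟨⟩∘ _ _ _ ⟩
    ⟨ π₁ ∘ assocʳ , (π₂ ∘ π₂) ∘ assocʳ ⟩  ≡⟨ ≡.cong₂ ⟨_,_⟩ (π₁-β _ _) π₂∘π₂∘assocʳ ⟩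
    ⟨ π₁ ∘ π₁ , π₂ ⟩                      ∎

  assocˡ : ∀ {e d c} → Hom (e ⊗ (d ⊗ c)) ((e ⊗ d) ⊗ c)
  assocˡ = ⟨ ⟨ π₁ , π₁ ∘ π₂ ⟩ , π₂ ∘ π₂ ⟩

  assocʳ∘assocˡ≡id : ∀ {e d c} → assocʳ ∘ assocˡ {e} {d} {c} ≡ id
  assocʳ∘assocˡ≡id = begin
    ⟨ π₁ ∘ π₁ , ⟨ π₂ ∘ π₁ , π₂ ⟩ ⟩ ∘ assocˡ             ≡⟨ ⟨⟩∘ _ _ _ ⟩
    ⟨ (π₁ ∘ π₁) ∘ assocˡ , ⟨ π₂ ∘ π₁ , π₂ ⟩ ∘ assocˡ ⟩  ≡⟨ ≡.cong₂ ⟨_,_⟩ (∘π₁∘assocˡ π₁) (⟨⟩∘ _ _ _) ⟩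
    ⟨ π₁ ∘ ⟨ π₁ , π₁ ∘ π₂ ⟩ , ⟨ (π₂ ∘ π₁) ∘ assocˡ , π₂ ∘ assocˡ ⟩ ⟩
                                                            ≡⟨ ≡.cong₂ (λ k l → ⟨ k , ⟨ l , π₂ ∘ assocˡ ⟩ ⟩)
                                                                 (π₁-β _ _) (∘π₁∘assocˡ π₂) ⟩
    ⟨ π₁ , ⟨ π₂ ∘ ⟨ π₁ , π₁ ∘ π₂ ⟩ , π₂ ∘ assocˡ ⟩ ⟩
        ≡⟨ ≡.cong₂ (λ k l → ⟨ π₁ , ⟨ k , l ⟩ ⟩) (π₂-β _ _) (π₂-β _ _) ⟩
    ⟨ π₁ , ⟨ π₁ ∘ π₂ , π₂ ∘ π₂ ⟩ ⟩                      ≡⟨ ≡.cong ⟨ π₁ ,_⟩ (≡.sym (⟨⟩-unique _ _ _ refl refl)) ⟩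
    ⟨ π₁ , π₂ ⟩                                         ≡⟨ ⟨π₁,π₂⟩≡id ⟩
    id                                                  ∎
    where
    ∘π₁∘assocˡ : ∀ {e d c x} (g : Hom (e ⊗ d) x) →
                 (g ∘ π₁) ∘ assocˡ {e} {d} {c} ≡ g ∘ ⟨ π₁ , π₁ ∘ π₂ ⟩
    ∘π₁∘assocˡ g = ≡.trans (assoc _ _ _) (≡.cong (g ∘_) (π₁-β _ _))

module FPFunctorProperties {ℓ} {C D : CartCat ℓ} (F : FPFunctor C D) where
  private
    module C = CartCat C
    module D = CartCat D
  open FPFunctor F
  open CartCatProperties D using (⟨⟩∘; retraction⇒monic)
  open ≡-Reasoning

  φ⁻¹ : ∀ {d c} → D.Hom (F₀ (d C.× c)) (F₀ d D.× F₀ c)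
  φ⁻¹ = D.⟨ F₁ C.π₁ , F₁ C.π₂ ⟩

  ∘φ⁻¹∘φ : ∀ {d c x} (g : D.Hom (F₀ d D.× F₀ c) x) → (g D.∘ φ⁻¹) D.∘ φ ≡ g
  ∘φ⁻¹∘φ g = begin
    (g D.∘ φ⁻¹) D.∘ φ  ≡⟨ D.assoc _ _ _ ⟩
    g D.∘ (φ⁻¹ D.∘ φ)  ≡⟨ ≡.cong (g D.∘_) φ-inverseʳ ⟩
    g D.∘ D.id         ≡⟨ D.identityʳ g ⟩
    g                  ∎

  Fπ₁∘φ : ∀ {d c} → F₁ C.π₁ D.∘ φ {d} {c} ≡ D.π₁
  Fπ₁∘φ = ≡.trans (≡.cong (D._∘ φ) (≡.sym (D.π₁-β _ _))) (∘φ⁻¹∘φ D.π₁)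

  Fπ₂∘φ : ∀ {d c} → F₁ C.π₂ D.∘ φ {d} {c} ≡ D.π₂
  Fπ₂∘φ = ≡.trans (≡.cong (D._∘ φ) (≡.sym (D.π₂-β _ _))) (∘φ⁻¹∘φ D.π₂)

  Fπ-jointly-monic : ∀ {x d c} {h h' : D.Hom x (F₀ (d C.× c))} →
    F₁ C.π₁ D.∘ h ≡ F₁ C.π₁ D.∘ h' → F₁ C.π₂ D.∘ h ≡ F₁ C.π₂ D.∘ h' → h ≡ h'
  Fπ-jointly-monic {h = h} {h'} p q = retraction⇒monic φ-inverseˡ (begin
    φ⁻¹ D.∘ h                              ≡⟨ ⟨⟩∘ _ _ _ ⟩
    D.⟨ F₁ C.π₁ D.∘ h , F₁ C.π₂ D.∘ h ⟩    ≡⟨ ≡.cong₂ D.⟨_,_⟩ p q ⟩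
    D.⟨ F₁ C.π₁ D.∘ h' , F₁ C.π₂ D.∘ h' ⟩  ≡⟨ ≡.sym (⟨⟩∘ _ _ _) ⟩
    φ⁻¹ D.∘ h'                             ∎)


  φ-natural : ∀ {d c' c} (f : C.Hom c' c) → φ {d} {c} D.∘ D.1× (F₁ f) ≡ F₁ (C.1× f) D.∘ φ
  φ-natural f = Fπ-jointly-monic
    (begin
      F₁ C.π₁ D.∘ (φ D.∘ D.1× (F₁ f))  ≡⟨ ≡.sym (D.assoc _ _ _) ⟩
      (F₁ C.π₁ D.∘ φ) D.∘ D.1× (F₁ f)  ≡⟨ ≡.cong (D._∘ D.1× (F₁ f)) Fπ₁∘φ ⟩
      D.π₁ D.∘ D.1× (F₁ f)             ≡⟨ D.π₁-β _ _ ⟩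
      D.π₁                             ≡⟨ ≡.sym Fπ₁∘φ ⟩
      F₁ C.π₁ D.∘ φ                    ≡⟨ ≡.cong (λ k → F₁ k D.∘ φ) (≡.sym (C.π₁-β _ _)) ⟩
      F₁ (C.π₁ C.∘ C.1× f) D.∘ φ       ≡⟨ ≡.cong (D._∘ φ) (F-∘ _ _) ⟩
      (F₁ C.π₁ D.∘ F₁ (C.1× f)) D.∘ φ  ≡⟨ D.assoc _ _ _ ⟩
      F₁ C.π₁ D.∘ (F₁ (C.1× f) D.∘ φ)  ∎)
    (begin
      F₁ C.π₂ D.∘ (φ D.∘ D.1× (F₁ f))  ≡⟨ ≡.sym (D.assoc _ _ _) ⟩
      (F₁ C.π₂ D.∘ φ) D.∘ D.1× (F₁ f)  ≡⟨ ≡.cong (D._∘ D.1× (F₁ f)) Fπ₂∘φ ⟩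
      D.π₂ D.∘ D.1× (F₁ f)             ≡⟨ D.π₂-β _ _ ⟩
      F₁ f D.∘ D.π₂                    ≡⟨ ≡.cong (F₁ f D.∘_) (≡.sym Fπ₂∘φ) ⟩
      F₁ f D.∘ (F₁ C.π₂ D.∘ φ)         ≡⟨ ≡.sym (D.assoc _ _ _) ⟩
      (F₁ f D.∘ F₁ C.π₂) D.∘ φ         ≡⟨ ≡.cong (D._∘ φ) (≡.sym (F-∘ _ _)) ⟩
      F₁ (f C.∘ C.π₂) D.∘ φ            ≡⟨ ≡.cong (λ k → F₁ k D.∘ φ) (≡.sym (C.π₂-β _ _)) ⟩
      F₁ (C.π₂ C.∘ C.1× f) D.∘ φ       ≡⟨ ≡.cong (D._∘ φ) (F-∘ _ _) ⟩
      (F₁ C.π₂ D.∘ F₁ (C.1× f)) D.∘ φ  ≡⟨ D.assoc _ _ _ ⟩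
      F₁ C.π₂ D.∘ (F₁ (C.1× f) D.∘ φ)  ∎)

  Fπ₂-section : ∀ {c} → D.Hom (F₀ c) (F₀ (C.𝟙 C.× c))
  Fπ₂-section {c} = φ D.∘ D.⟨ proj₁ (F𝟙-terminal (F₀ c)) , D.id ⟩

  Fπ₂∘Fπ₂-section : ∀ {c} → F₁ C.π₂ D.∘ Fπ₂-section {c} ≡ D.id
  Fπ₂∘Fπ₂-section {c} = begin
    F₁ C.π₂ D.∘ (φ D.∘ ⟨!,id⟩)  ≡⟨ ≡.sym (D.assoc _ _ _) ⟩
    (F₁ C.π₂ D.∘ φ) D.∘ ⟨!,id⟩  ≡⟨ ≡.cong (D._∘ ⟨!,id⟩) Fπ₂∘φ ⟩
    D.π₂ D.∘ ⟨!,id⟩             ≡⟨ D.π₂-β _ _ ⟩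
    D.id                        ∎
    where ⟨!,id⟩ = D.⟨ proj₁ (F𝟙-terminal (F₀ c)) , D.id ⟩

module DoctrineProperties {ℓ} {C : CartCat ℓ} (R : Doctrine C) where
  open CartCat C renaming (_×_ to _⊗_)
  open Doctrine R public
  open module Fibre {c : Obj} = BDLatProperties (fib c) public hiding (Carrier)
  open module Reindex {c' c : Obj} (f : Hom c' c) =
    IsLatticeHomProperties {L = fib c} {fib c'} (reindex-hom f) public
    using ()
    renaming (cong to reindex-cong; mono to reindex-mono; ∧-homo to reindex-∧;
              ∨-homo to reindex-∨; ⊥-homo to reindex-⊥)

  reindex-∘-≡ : ∀ {c'' c' c} {g : Hom c' c} {f : Hom c'' c'} {h : Hom c'' c} →
                g ∘ f ≡ h → ∀ x → reindex f (reindex g x) ≈ reindex h x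
  reindex-∘-≡ refl x = Eq.sym (reindex-∘ _ _ x)

  reindex-id-≡ : ∀ {c} {f : Hom c c} → f ≡ id → ∀ x → reindex f x ≈ x
  reindex-id-≡ refl = reindex-id

  reindex-reflects-≤ : ∀ {c' c} {p : Hom c' c} {s : Hom c c'} → p ∘ s ≡ id →
                       ∀ {x y} → reindex p x ≤ reindex p y → x ≤ y
  reindex-reflects-≤ {p = p} {s} p∘s≡id {x} {y} p*x≤p*y = begin
    x                        ≈⟨ Eq.sym (reindex-id-≡ p∘s≡id x) ⟩
    reindex (p ∘ s) x        ≈⟨ reindex-∘ p s x ⟩
    reindex s (reindex p x)  ≤⟨ reindex-mono s p*x≤p*y ⟩
    reindex s (reindex p y)  ≈⟨ Eq.sym (reindex-∘ p s y) ⟩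
    reindex (p ∘ s) y        ≈⟨ reindex-id-≡ p∘s≡id y ⟩
    y                        ∎
    where open ≤-Reasoning

module ExDoctrineProperties {ℓ} {C : CartCat ℓ} (Q : ExDoctrine C) where
  open CartCat C renaming (_×_ to _⊗_)
  open ExDoctrine Q public using (Σ∃; adjunction-⇒; adjunction-⇐; frobenius; beck-chevalley)
  open DoctrineProperties (ExDoctrine.doctrine Q) public

  Σ∃-adjoint : ∀ d {c} {y : Car (d ⊗ c)} {x : Car c} → Σ∃ d y ≤ x ⇔ y ≤ reindex (π d) x
  Σ∃-adjoint d = mk⇔ (adjunction-⇒ d _ _) (adjunction-⇐ d _ _)

  Σ∃-cong : ∀ d {c} {y y' : Car (d ⊗ c)} → y ≈ y' → Σ∃ d y ≈ Σ∃ d y'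
  Σ∃-cong d {c} =
    LeftAdjointProperties.cong {L = fib (d ⊗ c)} {fib c} (Σ∃ d) (reindex (π d)) (Σ∃-adjoint d)

module ExistsAlongFunctor {ℓ} {C D : CartCat ℓ} (Q : ExDoctrine D) (F : FPFunctor C D) where
  private
    module C = CartCat C
    module D = CartCat D
  open CartCatProperties C using (assocˡ; assocʳ∘assocˡ≡id; π₂∘π₂∘assocʳ)
  open ExDoctrineProperties Q
  open FPFunctor F
  open FPFunctorProperties F
  open Equivalence using (from)

  reindexᶠ : ∀ {a b} → C.Hom a b → Car (F₀ b) → Car (F₀ a)
  reindexᶠ f = reindex (F₁ f)

  reindexᶠ-∘-≡ : ∀ {a b c} {g : C.Hom a b} {h : C.Hom b c} {k : C.Hom a c} → h C.∘ g ≡ k →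
                 ∀ z → reindexᶠ g (reindexᶠ h z) ≈ reindexᶠ k z
  reindexᶠ-∘-≡ h∘g≡k = reindex-∘-≡ (≡.trans (≡.sym (F-∘ _ _)) (≡.cong F₁ h∘g≡k))

  reindexᶠ-inverse : ∀ {a b} {g : C.Hom a b} {h : C.Hom b a} → h C.∘ g ≡ C.id →
                     ∀ z → reindexᶠ g (reindexᶠ h z) ≈ z
  reindexᶠ-inverse h∘g≡id z = Eq.trans (reindexᶠ-∘-≡ h∘g≡id z) (reindex-id-≡ F-id z)

  -- Σ_{Fd} of the paper, which identifies F(d × c) with Fd × Fc.
  Σᶠ : (d : C.Obj) {c : C.Obj} → Car (F₀ (d C.× c)) → Car (F₀ c)
  Σᶠ d z = Σ∃ (F₀ d) (reindex φ z)

  Σᶠ-adjoint : ∀ d {c} {z : Car (F₀ (d C.× c))} {a : Car (F₀ c)} →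
               Σᶠ d z ≤ a ⇔ z ≤ reindexᶠ C.π₂ a
  Σᶠ-adjoint d {c} {z} {a} = mk⇔ transpose untranspose
    where
    open ≤-Reasoning
    transpose : Σᶠ d z ≤ a → z ≤ reindexᶠ C.π₂ a
    transpose Σᶠz≤a = begin
      z                             ≈⟨ Eq.sym (reindex-id-≡ φ-inverseˡ z) ⟩
      reindex (φ D.∘ φ⁻¹) z         ≈⟨ reindex-∘ φ φ⁻¹ z ⟩
      reindex φ⁻¹ (reindex φ z)     ≤⟨ reindex-mono φ⁻¹ (adjunction-⇒ (F₀ d) _ a Σᶠz≤a) ⟩
      reindex φ⁻¹ (reindex D.π₂ a)  ≈⟨ reindex-∘-≡ (D.π₂-β _ _) a ⟩
      reindexᶠ C.π₂ a               ∎
    untranspose : z ≤ reindexᶠ C.π₂ a → Σᶠ d z ≤ a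
    untranspose z≤π₂*a = adjunction-⇐ (F₀ d) _ a (begin
      reindex φ z                  ≤⟨ reindex-mono φ z≤π₂*a ⟩
      reindex φ (reindexᶠ C.π₂ a)  ≈⟨ reindex-∘-≡ Fπ₂∘φ a ⟩
      reindex D.π₂ a               ∎)

  open module Σᶠ-Adjunction d {c} =
    LeftAdjointProperties {L = fib (F₀ (d C.× c))} {fib (F₀ c)} (Σᶠ d) (reindexᶠ C.π₂) (Σᶠ-adjoint d)
    public using ()
    renaming (unit to Σᶠ-unit; counit to Σᶠ-counit; cong to Σᶠ-cong; ∨-homo to Σᶠ-∨; ⊥-homo to Σᶠ-⊥)

  Σᶠ-frobenius : ∀ d {c} (a : Car (F₀ c)) (z : Car (F₀ (d C.× c))) →
                 a ∧ Σᶠ d z ≈ Σᶠ d (reindexᶠ C.π₂ a ∧ z)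
  Σᶠ-frobenius d a z = begin
    a ∧ Σ∃ (F₀ d) (reindex φ z)                            ≈⟨ frobenius (F₀ d) a _ ⟩
    Σ∃ (F₀ d) (reindex D.π₂ a ∧ reindex φ z)
        ≈⟨ Σ∃-cong (F₀ d) (∧-cong (Eq.sym (reindex-∘-≡ Fπ₂∘φ a)) Eq.refl) ⟩
    Σ∃ (F₀ d) (reindex φ (reindexᶠ C.π₂ a) ∧ reindex φ z)  ≈⟨ Σ∃-cong (F₀ d) (Eq.sym (reindex-∧ φ _ _)) ⟩
    Σ∃ (F₀ d) (reindex φ (reindexᶠ C.π₂ a ∧ z))            ∎
    where open ≈-Reasoning

  Σᶠ-beck-chevalley : ∀ d {c' c} (f : C.Hom c' c) (z : Car (F₀ (d C.× c))) →
                      reindexᶠ f (Σᶠ d z) ≈ Σᶠ d (reindexᶠ (C.1× f) z)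
  Σᶠ-beck-chevalley d f z = begin
    reindexᶠ f (Σ∃ (F₀ d) (reindex φ z))           ≈⟨ beck-chevalley (F₀ d) (F₁ f) _ ⟩
    Σ∃ (F₀ d) (reindex (D.1× F₁ f) (reindex φ z))  ≈⟨ Σ∃-cong (F₀ d) (reindex-∘-≡ (φ-natural f) z) ⟩
    Σ∃ (F₀ d) (reindex (F₁ (C.1× f) D.∘ φ) z)      ≈⟨ Σ∃-cong (F₀ d) (reindex-∘ _ φ z) ⟩
    Σ∃ (F₀ d) (reindex φ (reindexᶠ (C.1× f) z))    ∎
    where open ≈-Reasoning

  Σᶠ-𝟙 : ∀ {c} (a : Car (F₀ c)) → Σᶠ C.𝟙 (reindexᶠ C.π₂ a) ≈ a
  Σᶠ-𝟙 a = antisym (Σᶠ-counit C.𝟙 a) (reindex-reflects-≤ Fπ₂∘Fπ₂-section (Σᶠ-unit C.𝟙 _))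

  Σᶠ-Σᶠ : ∀ d e {c} (z : Car (F₀ (e C.× (d C.× c)))) →
          Σᶠ d (Σᶠ e z) ≈ Σᶠ (e C.× d) (reindexᶠ C.assocʳ z)
  Σᶠ-Σᶠ d e z = antisym
    (from (Σᶠ-adjoint d) (from (Σᶠ-adjoint e) (begin
      z                                      ≈⟨ Eq.sym (reindexᶠ-inverse assocʳ∘assocˡ≡id z) ⟩
      reindexᶠ assocˡ (reindexᶠ C.assocʳ z)  ≤⟨ reindex-mono _ (Σᶠ-unit (e C.× d) _) ⟩
      reindexᶠ assocˡ (reindexᶠ C.π₂ rhs)    ≈⟨ reindexᶠ-∘-≡ (C.π₂-β _ _) rhs ⟩
      reindexᶠ (C.π₂ C.∘ C.π₂) rhs           ≈⟨ Eq.sym (reindexᶠ-∘-≡ refl rhs) ⟩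
      reindexᶠ C.π₂ (reindexᶠ C.π₂ rhs)      ∎)))
    (from (Σᶠ-adjoint (e C.× d)) (begin
      reindexᶠ C.assocʳ z                                    ≤⟨ reindex-mono _ (Σᶠ-unit e z) ⟩
      reindexᶠ C.assocʳ (reindexᶠ C.π₂ (Σᶠ e z))             ≤⟨ reindex-mono _ (reindex-mono _ (Σᶠ-unit d _)) ⟩
      reindexᶠ C.assocʳ (reindexᶠ C.π₂ (reindexᶠ C.π₂ lhs))  ≈⟨ reindex-cong _ (reindexᶠ-∘-≡ refl lhs) ⟩
      reindexᶠ C.assocʳ (reindexᶠ (C.π₂ C.∘ C.π₂) lhs)       ≈⟨ reindexᶠ-∘-≡ π₂∘π₂∘assocʳ lhs ⟩
      reindexᶠ C.π₂ lhs                                      ∎))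
    where
    open ≤-Reasoning
    lhs = Σᶠ d (Σᶠ e z)
    rhs = Σᶠ (e C.× d) (reindexᶠ C.assocʳ z)

module CompletionProperties {ℓ} {C : CartCat ℓ} (P : Doctrine C) where
  open CartCat C renaming (_×_ to _⊗_)
  open CartCatProperties C
  open DoctrineProperties P
  open Completion P

  Arrow-∷ : ∀ {c d} {e : Entry c} {Y : Pᴱ₀ c} → Arrow d Y → Arrow d (e ∷ Y)
  Arrow-∷ (j , r) = suc j , r

  Arrow-++ˡ : ∀ {c d} (X Y : Pᴱ₀ c) → Arrow d X → Arrow d (X ++ Y)
  Arrow-++ˡ (e ∷ X) Y (zero  , r) = zero , r
  Arrow-++ˡ (e ∷ X) Y (suc j , r) = Arrow-∷ (Arrow-++ˡ X Y (j , r))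

  pull-Arrow-++ˡ : ∀ {c d} (X Y : Pᴱ₀ c) (a : Arrow d X) → pull (X ++ Y) (Arrow-++ˡ X Y a) ≡ pull X a
  pull-Arrow-++ˡ (e ∷ X) Y (zero  , r) = refl
  pull-Arrow-++ˡ (e ∷ X) Y (suc j , r) = pull-Arrow-++ˡ X Y (j , r)

  Arrow-++ʳ : ∀ {c d} (X Y : Pᴱ₀ c) → Arrow d Y → Arrow d (X ++ Y)
  Arrow-++ʳ []      Y a = a
  Arrow-++ʳ (e ∷ X) Y a = Arrow-∷ (Arrow-++ʳ X Y a)

  pull-Arrow-++ʳ : ∀ {c d} (X Y : Pᴱ₀ c) (a : Arrow d Y) → pull (X ++ Y) (Arrow-++ʳ X Y a) ≡ pull Y a
  pull-Arrow-++ʳ []      Y a = refl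
  pull-Arrow-++ʳ (e ∷ X) Y a = pull-Arrow-++ʳ X Y a

  Covered-map : ∀ {c} {Y Y' : Pᴱ₀ c} (f : ∀ {d} → Arrow d Y → Arrow d Y') →
                (∀ {d} (a : Arrow d Y) → pull Y' (f a) ≡ pull Y a) →
                ∀ {e} → Covered Y e → Covered Y' e
  Covered-map {Y = Y} {Y'} f pull-f {d , x} (rs , x≤⋁) =
    map f rs , ≡.subst (λ ys → x ≤ ⋁ ys) (≡.sym pulls-f) x≤⋁
    where
    pulls-f : map (pull Y') (map f rs) ≡ map (pull Y) rs
    pulls-f = ≡.trans (≡.sym (map-∘ rs)) (map-cong pull-f rs)

  Covered-++ˡ : ∀ {c} (X Y : Pᴱ₀ c) {e} → Covered X e → Covered (X ++ Y) e
  Covered-++ˡ X Y = Covered-map {Y = X} {X ++ Y} (Arrow-++ˡ X Y) (pull-Arrow-++ˡ X Y)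

  Covered-++ʳ : ∀ {c} (X Y : Pᴱ₀ c) {e} → Covered Y e → Covered (X ++ Y) e
  Covered-++ʳ X Y = Covered-map {Y = Y} {X ++ Y} (Arrow-++ʳ X Y) (pull-Arrow-++ʳ X Y)

  Covered-here : ∀ {c} {e e' : Entry c} {Y : Pᴱ₀ c} (r : Hom (proj₁ e' ⊗ c) (proj₁ e ⊗ c)) →
                 π₂ ∘ r ≡ π₂ → proj₂ e' ≤ reindex r (proj₂ e) → Covered (e ∷ Y) e'
  Covered-here r π₂∘r≡π₂ x≤r*y = ((zero , r , π₂∘r≡π₂) ∷ []) , ≤-trans x≤r*y (x≤x∨y _ _)

  ⊑ᴱ-refl : ∀ {c} (X : Pᴱ₀ c) → X ⊑ᴱ X
  ⊑ᴱ-refl []      = []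
  ⊑ᴱ-refl (e ∷ X) = Covered-here id (identityʳ π₂) (reflexive (Eq.sym (reindex-id _)))
                  ∷ All.map (Covered-++ʳ (e ∷ []) X) (⊑ᴱ-refl X)

  ⊑ᴱ-++ˡ : ∀ {c} (X Y : Pᴱ₀ c) → X ⊑ᴱ (X ++ Y)
  ⊑ᴱ-++ˡ X Y = All.map (Covered-++ˡ X Y) (⊑ᴱ-refl X)

  ⊑ᴱ-++ʳ : ∀ {c} (X Y : Pᴱ₀ c) → Y ⊑ᴱ (X ++ Y)
  ⊑ᴱ-++ʳ X Y = All.map (Covered-++ʳ X Y) (⊑ᴱ-refl Y)

  ++-isJoin : ∀ {c} {L : BDLat ℓ} (X Y : Pᴱ₀ c) → IsJoinOf _⊑ᴱ_ L X Y (X ++ Y)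
  ++-isJoin X Y = ⊑ᴱ-++ˡ X Y , ⊑ᴱ-++ʳ X Y , λ _ → ++⁺

  []-isLeast : ∀ {c} {L : BDLat ℓ} → IsLeast (_⊑ᴱ_ {c}) L []
  []-isLeast _ = []

  _⊓ₑ_ : ∀ {c} → Entry c → Entry c → Entry c
  (d , x) ⊓ₑ (e , y) = d ⊗ e , reindex (π₁ ×₁) x ∧ reindex (π₂ ×₁) y

  _⊓ᴱ_ : ∀ {c} → Pᴱ₀ c → Pᴱ₀ c → Pᴱ₀ c
  _⊓ᴱ_ = cartesianProductWith _⊓ₑ_

  ⊓ᴱ-lowerˡ : ∀ {c} (X Y : Pᴱ₀ c) → (X ⊓ᴱ Y) ⊑ᴱ X
  ⊓ᴱ-lowerˡ []      Y = []
  ⊓ᴱ-lowerˡ (e ∷ X) Y = ++⁺ (map⁺ (All.universal (λ _ → Covered-here (π₁ ×₁) (π₂-β _ _) (x∧y≤x _ _)) Y))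
                            (All.map (Covered-++ʳ (e ∷ []) X) (⊓ᴱ-lowerˡ X Y))

  ⊓ᴱ-lowerʳ : ∀ {c} (X Y : Pᴱ₀ c) → (X ⊓ᴱ Y) ⊑ᴱ Y
  ⊓ᴱ-lowerʳ []      Y = []
  ⊓ᴱ-lowerʳ (e ∷ X) Y = ++⁺ (map-⊓ₑ-lowerʳ Y) (⊓ᴱ-lowerʳ X Y)
    where
    map-⊓ₑ-lowerʳ : ∀ Y → map (e ⊓ₑ_) Y ⊑ᴱ Y
    map-⊓ₑ-lowerʳ []       = []
    map-⊓ₑ-lowerʳ (e' ∷ Y) = Covered-here (π₂ ×₁) (π₂-β _ _) (x∧y≤y _ _)
                           ∷ All.map (Covered-++ʳ (e' ∷ []) Y) (map-⊓ₑ-lowerʳ Y)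

  reindex-assocʳ-π₂ : ∀ {e d c} (x : Car (d ⊗ c)) →
                      reindex (assocʳ {e}) (reindex π₂ x) ≈ reindex (π₂ ×₁) x
  reindex-assocʳ-π₂ = reindex-∘-≡ (π₂-β _ _)

  singleton⊑Σᴱη : ∀ d {c} (x : Car (d ⊗ c)) → ((d , x) ∷ []) ⊑ᴱ Σᴱ d (η (d ⊗ c) x)
  singleton⊑Σᴱη d x = Covered-here (⟨ ! , id ⟩ ×₁) (π₂-β _ _) (begin
      x                                                        ≈⟨ Eq.sym (reindex-id-≡ π₂×₁-retraction x) ⟩
      reindex ((π₂ ×₁) ∘ (⟨ ! , id ⟩ ×₁)) x                    ≈⟨ reindex-∘ _ _ x ⟩
      reindex (⟨ ! , id ⟩ ×₁) (reindex (π₂ ×₁) x)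
          ≈⟨ reindex-cong _ (Eq.sym (reindex-assocʳ-π₂ x)) ⟩
      reindex (⟨ ! , id ⟩ ×₁) (reindex assocʳ (reindex π₂ x))  ∎)
    ∷ []
    where
    open ≤-Reasoning
    π₂×₁-retraction : (π₂ ×₁) ∘ (⟨ ! , id ⟩ ×₁) ≡ id {d ⊗ _}
    π₂×₁-retraction = ≡.trans (×₁-∘ _ _) (≡.trans (≡.cong _×₁ (π₂-β _ _)) id×₁)

  Σᴱη⊑singleton : ∀ d {c} (x : Car (d ⊗ c)) → Σᴱ d (η (d ⊗ c) x) ⊑ᴱ ((d , x) ∷ [])
  Σᴱη⊑singleton d x = Covered-here (π₂ ×₁) (π₂-β _ _) (reflexive (reindex-assocʳ-π₂ x)) ∷ []

module Extension {ℓ} {C D : CartCat ℓ} (P : Doctrine C) (Q : ExDoctrine D) (F : FPFunctor C D)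
  (α : ∀ c → Doctrine.Car P c → Doctrine.Car (ExDoctrine.doctrine Q) (FPFunctor.F₀ F c))
  (α-morphism : IsDoctrineMorphism F (toRaw P) (ExDoctrine.doctrine Q) α) where
  open CartCat C renaming (_×_ to _⊗_)
  open CartCatProperties C
  open FPFunctor F using (F₀)
  open Completion P
  open CompletionProperties P
  open ExistsAlongFunctor Q F
  open ExDoctrineProperties Q
  private
    module P = DoctrineProperties P
    module α c =
      IsLatticeHomProperties {L = P.fib c} {fib (F₀ c)} (IsDoctrineMorphism.components α-morphism c)
  open IsDoctrineMorphism α-morphism using () renaming (natural to α-natural)
  open Equivalence using (from)

  αᴱ-entry : ∀ {c} → Entry c → Car (F₀ c)
  αᴱ-entry {c} (d , x) = Σᶠ d (α (d ⊗ c) x)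

  αᴱ : ∀ c → Pᴱ₀ c → Car (F₀ c)
  αᴱ c X = ⋁ (map αᴱ-entry X)

  αᴱ-++ : ∀ {c} (X Y : Pᴱ₀ c) → αᴱ c (X ++ Y) ≈ αᴱ c X ∨ αᴱ c Y
  αᴱ-++ X Y = Eq.trans (Eq.reflexive (≡.cong ⋁ (map-++ αᴱ-entry X Y)))
                       (⋁-++ (map αᴱ-entry X) (map αᴱ-entry Y))

  pull-≤ : ∀ {c d} (Y : Pᴱ₀ c) (a : Arrow d Y) → α (d ⊗ c) (pull Y a) ≤ reindexᶠ π₂ (αᴱ c Y)
  pull-≤ {c} Y (j , r , π₂∘r≡π₂) = begin
    α _ (P.reindex r y)                          ≈⟨ α-natural r y ⟩
    reindexᶠ r (α _ y)                           ≤⟨ reindex-mono _ (Σᶠ-unit e (α _ y)) ⟩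
    reindexᶠ r (reindexᶠ π₂ (αᴱ-entry (e , y)))  ≈⟨ reindexᶠ-∘-≡ π₂∘r≡π₂ _ ⟩
    reindexᶠ π₂ (αᴱ-entry (lookup Y j))          ≤⟨ reindex-mono _ (lookup-≤-⋁-map αᴱ-entry Y j) ⟩
    reindexᶠ π₂ (αᴱ c Y)                         ∎
    where
    open ≤-Reasoning
    e = proj₁ (lookup Y j)
    y = proj₂ (lookup Y j)

  Covered⇒≤ : ∀ {c} (Y : Pᴱ₀ c) {e} → Covered Y e → αᴱ-entry e ≤ αᴱ c Y
  Covered⇒≤ {c} Y {d , x} (rs , x≤⋁) = from (Σᶠ-adjoint d) (≤-trans (α.mono _ x≤⋁) (pulls-≤ rs))
    where
    pulls-≤ : ∀ rs → α (d ⊗ c) (P.⋁ (map (pull Y) rs)) ≤ reindexᶠ π₂ (αᴱ c Y)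
    pulls-≤ []       = ≤-trans (reflexive (α.⊥-homo _)) (minimum _)
    pulls-≤ (a ∷ rs) = ≤-trans (reflexive (α.∨-homo _ _ _)) (∨-least (pull-≤ Y a) (pulls-≤ rs))

  αᴱ-mono : ∀ {c} (X Y : Pᴱ₀ c) → X ⊑ᴱ Y → αᴱ c X ≤ αᴱ c Y
  αᴱ-mono []      Y []                  = minimum _
  αᴱ-mono (e ∷ X) Y (e-covered ∷ X⊑Y) = ∨-least (Covered⇒≤ Y e-covered) (αᴱ-mono X Y X⊑Y)

  αᴱ-entry-⊓ₑ : ∀ {c} (e e' : Entry c) → αᴱ-entry e ∧ αᴱ-entry e' ≈ αᴱ-entry (e ⊓ₑ e')
  αᴱ-entry-⊓ₑ {c} (d , x) (e , y) = begin
    Σᶠ d A ∧ Σᶠ e B                                                     ≈⟨ Σᶠ-frobenius e _ _ ⟩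
    Σᶠ e (reindexᶠ π₂ (Σᶠ d A) ∧ B)
        ≈⟨ Σᶠ-cong e (∧-cong (Σᶠ-beck-chevalley d π₂ A) Eq.refl) ⟩
    Σᶠ e (Σᶠ d (reindexᶠ (1× π₂) A) ∧ B)                                ≈⟨ Σᶠ-cong e (∧-comm _ _) ⟩
    Σᶠ e (B ∧ Σᶠ d (reindexᶠ (1× π₂) A))                                ≈⟨ Σᶠ-cong e (Σᶠ-frobenius d _ _) ⟩
    Σᶠ e (Σᶠ d (reindexᶠ π₂ B ∧ reindexᶠ (1× π₂) A))                    ≈⟨ Σᶠ-Σᶠ e d _ ⟩
    Σᶠ (d ⊗ e) (reindexᶠ assocʳ (reindexᶠ π₂ B ∧ reindexᶠ (1× π₂) A))   ≈⟨ Σᶠ-cong (d ⊗ e) (reindex-∧ _ _ _) ⟩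
    Σᶠ (d ⊗ e) (reindexᶠ assocʳ (reindexᶠ π₂ B) ∧ reindexᶠ assocʳ (reindexᶠ (1× π₂) A))
        ≈⟨ Σᶠ-cong (d ⊗ e) (∧-cong (reindexᶠ-∘-≡ (π₂-β _ _) B) (reindexᶠ-∘-≡ 1×π₂∘assocʳ A)) ⟩
    Σᶠ (d ⊗ e) (reindexᶠ (π₂ ×₁) B ∧ reindexᶠ (π₁ ×₁) A)                ≈⟨ Σᶠ-cong (d ⊗ e) (∧-comm _ _) ⟩
    Σᶠ (d ⊗ e) (reindexᶠ (π₁ ×₁) A ∧ reindexᶠ (π₂ ×₁) B)
        ≈⟨ Σᶠ-cong (d ⊗ e) (∧-cong (Eq.sym (α-natural _ x)) (Eq.sym (α-natural _ y))) ⟩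
    Σᶠ (d ⊗ e) (α _ (P.reindex (π₁ ×₁) x) ∧ α _ (P.reindex (π₂ ×₁) y))
        ≈⟨ Σᶠ-cong (d ⊗ e) (Eq.sym (α.∧-homo _ _ _)) ⟩
    Σᶠ (d ⊗ e) (α _ (P.reindex (π₁ ×₁) x P.∧ P.reindex (π₂ ×₁) y))      ∎
    where
    open ≈-Reasoning
    A = α (d ⊗ c) x
    B = α (e ⊗ c) y

  αᴱ-entry-∧-αᴱ : ∀ {c} (e : Entry c) (Y : Pᴱ₀ c) → αᴱ-entry e ∧ αᴱ c Y ≤ αᴱ c (map (e ⊓ₑ_) Y)
  αᴱ-entry-∧-αᴱ e []       = x∧y≤y _ _
  αᴱ-entry-∧-αᴱ {c} e (e' ∷ Y) = begin
    αᴱ-entry e ∧ (αᴱ-entry e' ∨ αᴱ c Y)                 ≈⟨ ∧-distribˡ-∨ _ _ _ ⟩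
    (αᴱ-entry e ∧ αᴱ-entry e') ∨ (αᴱ-entry e ∧ αᴱ c Y)
        ≤⟨ ∨-monotonic (reflexive (αᴱ-entry-⊓ₑ e e')) (αᴱ-entry-∧-αᴱ e Y) ⟩
    αᴱ-entry (e ⊓ₑ e') ∨ αᴱ c (map (e ⊓ₑ_) Y)           ∎
    where open ≤-Reasoning

  αᴱ-∧ : ∀ {c} (X Y : Pᴱ₀ c) → αᴱ c X ∧ αᴱ c Y ≤ αᴱ c (X ⊓ᴱ Y)
  αᴱ-∧ []      Y = x∧y≤x _ _
  αᴱ-∧ {c} (e ∷ X) Y = begin
    (αᴱ-entry e ∨ αᴱ c X) ∧ αᴱ c Y             ≈⟨ ∧-distribʳ-∨ _ _ _ ⟩
    (αᴱ-entry e ∧ αᴱ c Y) ∨ (αᴱ c X ∧ αᴱ c Y)  ≤⟨ ∨-monotonic (αᴱ-entry-∧-αᴱ e Y) (αᴱ-∧ X Y) ⟩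
    αᴱ c (map (e ⊓ₑ_) Y) ∨ αᴱ c (X ⊓ᴱ Y)       ≈⟨ Eq.sym (αᴱ-++ (map (e ⊓ₑ_) Y) (X ⊓ᴱ Y)) ⟩
    αᴱ c ((e ∷ X) ⊓ᴱ Y)                        ∎
    where open ≤-Reasoning

  αᴱ-η : ∀ c x → αᴱ c (η c x) ≈ α c x
  αᴱ-η c x = begin
    Σᶠ 𝟙 (α _ (P.reindex π₂ x)) ∨ ⊥  ≈⟨ ∨-identityʳ _ ⟩
    Σᶠ 𝟙 (α _ (P.reindex π₂ x))      ≈⟨ Σᶠ-cong 𝟙 (α-natural π₂ x) ⟩
    Σᶠ 𝟙 (reindexᶠ π₂ (α c x))       ≈⟨ Σᶠ-𝟙 _ ⟩
    α c x                            ∎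
    where open ≈-Reasoning

  αᴱ-isLatticeHom : ∀ c → IsLatticeHom (_⊑ᴱ_ {c}) (fib (F₀ c)) (αᴱ c)
  αᴱ-isLatticeHom c = record
    { resp   = λ X Y X⊑Y Y⊑X → antisym (αᴱ-mono X Y X⊑Y) (αᴱ-mono Y X Y⊑X)
    ; pres-⊤ = λ t t-greatest → antisym (maximum _) (⊤≤αᴱ t t-greatest)
    ; pres-⊥ = λ b b-least → antisym (αᴱ-mono b [] (b-least [])) (minimum _)
    ; pres-∧ = λ { X Y m (m⊑X , m⊑Y , m-greatest) → antisym
        (∧-greatest (αᴱ-mono m X m⊑X) (αᴱ-mono m Y m⊑Y))
        (≤-trans (αᴱ-∧ X Y) (αᴱ-mono (X ⊓ᴱ Y) m (m-greatest (X ⊓ᴱ Y) (⊓ᴱ-lowerˡ X Y) (⊓ᴱ-lowerʳ X Y)))) }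
    ; pres-∨ = λ { X Y j (X⊑j , Y⊑j , j-least) → antisym
        (≤-trans (αᴱ-mono j (X ++ Y) (j-least (X ++ Y) (⊑ᴱ-++ˡ X Y) (⊑ᴱ-++ʳ X Y))) (reflexive (αᴱ-++ X Y)))
        (∨-least (αᴱ-mono X j X⊑j) (αᴱ-mono Y j Y⊑j)) }
    }
    where
    ⊤≤αᴱ : ∀ t → IsGreatest _⊑ᴱ_ (fib (F₀ c)) t → ⊤ ≤ αᴱ c t
    ⊤≤αᴱ t t-greatest = begin
      ⊤               ≈⟨ Eq.sym (α.⊤-homo c) ⟩
      α c P.⊤         ≈⟨ Eq.sym (αᴱ-η c P.⊤) ⟩
      αᴱ c (η c P.⊤)  ≤⟨ αᴱ-mono (η c P.⊤) t (t-greatest _) ⟩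
      αᴱ c t          ∎
      where open ≤-Reasoning

  αᴱ-natural : ∀ {c' c} (f : Hom c' c) (X : Pᴱ₀ c) → αᴱ c' (reindexᴱ f X) ≈ reindexᶠ f (αᴱ c X)
  αᴱ-natural f []            = Eq.sym (reindex-⊥ _)
  αᴱ-natural f ((d , x) ∷ X) = begin
    Σᶠ d (α _ (P.reindex (1× f) x)) ∨ αᴱ _ (reindexᴱ f X)
        ≈⟨ ∨-cong (Σᶠ-cong d (α-natural _ x)) (αᴱ-natural f X) ⟩
    Σᶠ d (reindexᶠ (1× f) (α _ x)) ∨ reindexᶠ f (αᴱ _ X)
        ≈⟨ ∨-cong (Eq.sym (Σᶠ-beck-chevalley d f _)) Eq.refl ⟩
    reindexᶠ f (Σᶠ d (α _ x)) ∨ reindexᶠ f (αᴱ _ X)        ≈⟨ Eq.sym (reindex-∨ _ _ _) ⟩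
    reindexᶠ f (αᴱ _ ((d , x) ∷ X))                        ∎
    where open ≈-Reasoning

  αᴱ-isDoctrineMorphism : IsDoctrineMorphism F Pᴱ (ExDoctrine.doctrine Q) αᴱ
  αᴱ-isDoctrineMorphism = record { natural = αᴱ-natural ; components = αᴱ-isLatticeHom }

  αᴱ-preservesΣ : PreservesΣ F Pᴱ Σᴱ Q αᴱ
  αᴱ-preservesΣ d []            = Eq.sym (Σᶠ-⊥ d)
  αᴱ-preservesΣ d ((e , x) ∷ Y) = begin
    Σᶠ (e ⊗ d) (α _ (P.reindex assocʳ x)) ∨ αᴱ _ (Σᴱ d Y)
        ≈⟨ ∨-cong (Σᶠ-cong (e ⊗ d) (α-natural assocʳ x)) (αᴱ-preservesΣ d Y) ⟩
    Σᶠ (e ⊗ d) (reindexᶠ assocʳ (α _ x)) ∨ Σᶠ d (αᴱ _ Y)   ≈⟨ ∨-cong (Eq.sym (Σᶠ-Σᶠ d e _)) Eq.refl ⟩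
    Σᶠ d (Σᶠ e (α _ x)) ∨ Σᶠ d (αᴱ _ Y)                    ≈⟨ Eq.sym (Σᶠ-∨ d _ _) ⟩
    Σᶠ d (αᴱ _ ((e , x) ∷ Y))                              ∎
    where open ≈-Reasoning

  module _ (β : ∀ c → Pᴱ₀ c → Car (F₀ c))
           (β-morphism : IsDoctrineMorphism F Pᴱ (ExDoctrine.doctrine Q) β)
           (β-preservesΣ : PreservesΣ F Pᴱ Σᴱ Q β)
           (β-η : ∀ c x → β c (η c x) ≈ α c x) where
    private
      module β c = IsLatticeHom (IsDoctrineMorphism.components β-morphism c)

    β-singleton : ∀ {c} (e : Entry c) → β c (e ∷ []) ≈ αᴱ-entry e
    β-singleton {c} (d , x) = begin
      β c ((d , x) ∷ [])        ≈⟨ β.resp c _ _ (singleton⊑Σᴱη d x) (Σᴱη⊑singleton d x) ⟩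
      β c (Σᴱ d (η (d ⊗ c) x))  ≈⟨ β-preservesΣ d _ ⟩
      Σᶠ d (β _ (η (d ⊗ c) x))  ≈⟨ Σᶠ-cong d (β-η _ x) ⟩
      Σᶠ d (α _ x)              ∎
      where open ≈-Reasoning

    αᴱ-unique : ∀ c X → β c X ≈ αᴱ c X
    αᴱ-unique c []      = β.pres-⊥ c [] ([]-isLeast {L = fib (F₀ c)})
    αᴱ-unique c (e ∷ X) = begin
      β c (e ∷ X)           ≈⟨ β.pres-∨ c (e ∷ []) X (e ∷ X) (++-isJoin {L = fib (F₀ c)} (e ∷ []) X) ⟩
      β c (e ∷ []) ∨ β c X  ≈⟨ ∨-cong (β-singleton e) (αᴱ-unique c X) ⟩
      αᴱ-entry e ∨ αᴱ c X   ∎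
      where open ≈-Reasoning

proposition4p8 : ∀ {ℓ} {C D : CartCat ℓ} (P : Doctrine C) (Q : ExDoctrine D)
  (F : FPFunctor C D)
  (α : ∀ c → Doctrine.Car P c → Doctrine.Car (ExDoctrine.doctrine Q) (FPFunctor.F₀ F c)) →
  IsDoctrineMorphism F (toRaw P) (ExDoctrine.doctrine Q) α →
  Σ[ αᴱ ∈ (∀ c → Completion.Pᴱ₀ P c → Doctrine.Car (ExDoctrine.doctrine Q) (FPFunctor.F₀ F c)) ]
    ((IsDoctrineMorphism F (Completion.Pᴱ P) (ExDoctrine.doctrine Q) αᴱ
      × PreservesΣ F (Completion.Pᴱ P) (Completion.Σᴱ P) Q αᴱ
      × (∀ c x → BDLat._≈_ (Doctrine.fib (ExDoctrine.doctrine Q) (FPFunctor.F₀ F c))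
                   (αᴱ c (Completion.η P c x)) (α c x)))
    × (∀ (β : ∀ c → Completion.Pᴱ₀ P c → Doctrine.Car (ExDoctrine.doctrine Q) (FPFunctor.F₀ F c)) →
         IsDoctrineMorphism F (Completion.Pᴱ P) (ExDoctrine.doctrine Q) β →
         PreservesΣ F (Completion.Pᴱ P) (Completion.Σᴱ P) Q β →
         (∀ c x → BDLat._≈_ (Doctrine.fib (ExDoctrine.doctrine Q) (FPFunctor.F₀ F c))
                    (β c (Completion.η P c x)) (α c x)) →
         ∀ c X → BDLat._≈_ (Doctrine.fib (ExDoctrine.doctrine Q) (FPFunctor.F₀ F c))
                   (β c X) (αᴱ c X)))
proposition4p8 P Q F α α-morphism =
  αᴱ , (αᴱ-isDoctrineMorphism , αᴱ-preservesΣ , αᴱ-η) , αᴱ-unique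
  where open Extension P Q F α α-morphism
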